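{- Let $B$ be an $(n,n-1)$-blocker for a convex $n$-gon $C$ with vertices $0,\dots,n-1$ (indices mod $n$). If the ear-cover $(i-1,i+1)$ does not belong to $B$, then $\deg_B(i)\le 2$.
   Context: A triangulation of a convex polygon is a maximal set of pairwise non-crossing diagonals. A blocker is a set of edges sharing an edge with every triangulation; it is saturated if removing any of its edges yields a non-blocker; an $(n,k)$-blocker is a saturated blocker with $k$ edges for a convex $n$-gon. An ear-cover is a diagonal $(i-1,i+1)$. $\deg_B(i)$ is the number of edges of $B$ incident to $i$. -}

module Defs where

open import Data.Nat using (ℕ; zero; suc; _+_; _∸_; _≤_; _<_; _≟_; _≤ᵇ_)
open import Data.Nat.DivMod using (_%_)
open import Data.Bool using (if_then_else_)
open import Data.Product using (_×_; _,_; proj₁; proj₂; ∃)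
open import Data.Product.Properties using (≡-dec)
open import Data.Sum using (_⊎_)
open import Data.List using (List; filter; length)
open import Data.List.Membership.Propositional using (_∈_; _∉_)
open import Data.List.Relation.Unary.Unique.Propositional using (Unique)
open import Relation.Nullary using (¬_; ¬?)
open import Relation.Nullary.Decidable using (_⊎-dec_)
open import Relation.Binary.PropositionalEquality using (_≡_)

-- Vertices of the convex n-gon are the naturals 0,…,n-1 (in cyclic order).
-- An edge (segment) is a pair (i , j) of vertices; we store it normalised
-- with i < j.
Edge : Set
Edge = ℕ × ℕ

IsDiagonal : ℕ → Edge → Set
IsDiagonal n (i , j) = (i + 2 ≤ j) × (j < n) × ¬ ((i ≡ 0) × (suc j ≡ n))

-- Two diagonals cross (intersect in their relative interiors) iff their
-- endpoints strictly interleave around the polygon.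
Cross : Edge → Edge → Set
Cross (a , b) (c , d) = ((a < c) × (c < b) × (b < d)) ⊎ ((c < a) × (a < d) × (d < b))

record IsTriangulation (n : ℕ) (T : List Edge) : Set where
  field
    diagonals   : ∀ {e} → e ∈ T → IsDiagonal n e
    nonCrossing : ∀ {e f} → e ∈ T → f ∈ T → ¬ Cross e f
    maximal     : ∀ d → IsDiagonal n d → d ∉ T → ∃ λ f → (f ∈ T) × Cross d f

IsBlocker : ℕ → List Edge → Set
IsBlocker n B = ∀ T → IsTriangulation n T → ∃ λ e → (e ∈ B) × (e ∈ T)

remove : Edge → List Edge → List Edge
remove e B = filter (λ f → ¬? (≡-dec _≟_ _≟_ f e)) B

IsSaturated : ℕ → List Edge → Set
IsSaturated n B = ∀ {e} → e ∈ B → ¬ IsBlocker n (remove e B)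

record IsNKBlocker (n k : ℕ) (B : List Edge) : Set where
  field
    edgesDiagonals : ∀ {e} → e ∈ B → IsDiagonal n e
    distinct       : Unique B
    size           : length B ≡ k
    blocker        : IsBlocker n B
    saturated      : IsSaturated n B

-- reduction modulo n (n = 0 never occurs in use)
mod : ℕ → ℕ → ℕ
mod a zero    = 0
mod a (suc m) = a % suc m

edge : ℕ → ℕ → Edge
edge a b = if a ≤ᵇ b then (a , b) else (b , a)

earCover : ℕ → ℕ → Edge
earCover n i = edge (mod (i + n ∸ 1) n) (mod (suc i) n)

deg : List Edge → ℕ → ℕ
deg B i = length (filter (λ e → (proj₁ e ≟ i) ⊎-dec (proj₂ e ≟ i)) B)

-- If deg_B(i) ≥ 3, then since |B| = n - 1 at most n - 4 edges of B avoid the vertex i. But any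
-- m - 3 edges are missed by some triangulation of a convex m-gon: some middle vertex has its
-- ear-cover outside the set and either touches one of the edges or leaves room to spare (otherwise
-- touching spreads along the polygon and all m - 2 middle ear-covers would lie in the set), so it can
-- be cut off and the (m-1)-gon that remains handled recursively. Applied to the (n-1)-gon left after
-- deleting i, this yields a triangulation missing every edge of B off i; adding the ear-cover of i
-- gives a triangulation of the n-gon disjoint from B.

module Submission where

open import Defs
open import Data.Nat using (ℕ; zero; suc; _+_; _∸_; _≤_; _<_; _≟_; _≤?_; _<?_; _≤ᵇ_; z≤n; s≤s)
open import Data.Nat.Properties
open import Data.Nat.DivMod using (m<n⇒m%n≡m; [m+n]%n≡m%n; n%n≡0)
open import Data.Bool using (true; false)
open import Data.Unit using (tt)
open import Data.Empty using (⊥; ⊥-elim)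
open import Data.Product using (_×_; _,_; proj₁; proj₂; ∃)
open import Data.Product.Properties using (≡-dec)
open import Data.Sum using (_⊎_; inj₁; inj₂; [_,_]′)
open import Data.List using (List; []; _∷_; filter; length)
open import Data.List.Properties using (filter-notAll; length-filter)
open import Data.List.Membership.Propositional using (_∈_; _∉_; lose)
open import Data.List.Membership.Propositional.Properties using (∈-filter⁺; ∈-filter⁻)
open import Data.List.Membership.DecPropositional (≡-dec _≟_ _≟_) using (_∈?_)
open import Data.List.Relation.Unary.Any using (Any; here; there; any?)
import Data.List.Relation.Unary.Any as Any
open import Relation.Nullary using (¬_; ¬?; Dec; yes; no)
open import Relation.Nullary.Decidable using (_⊎-dec_; _×-dec_)
open import Relation.Binary.Definitions using (DecidableEquality; tri<; tri≈; tri>)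
open import Relation.Binary.PropositionalEquality using (_≡_; _≢_; refl; sym; trans; cong; cong₂; subst; module ≡-Reasoning)
open import Function using (_∘_; id)

module _ {P : ℕ → Set} {r : ℕ} (step⁺ : ∀ {k} → suc k < r → P k → P (suc k))
                               (step⁻ : ∀ {k} → suc k < r → P (suc k) → P k) where

  neighbourClosed-all : ∀ {k₀} → k₀ < r → P k₀ → ∀ {k} → k < r → P k
  neighbourClosed-all k₀<r Pk₀ = upFrom0 (downTo0 k₀<r Pk₀)
    where
    downTo0 : ∀ {k} → k < r → P k → P 0
    downTo0 {zero}  _     Pk   = Pk
    downTo0 {suc k} k+1<r Pk+1 = downTo0 (<-trans (n<1+n k) k+1<r) (step⁻ k+1<r Pk+1)
    upFrom0 : P 0 → ∀ {k} → k < r → P k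
    upFrom0 P0 {zero}  _     = P0
    upFrom0 P0 {suc k} k+1<r = step⁺ k+1<r (upFrom0 P0 (<-trans (n<1+n k) k+1<r))

module _ {A : Set} (_≟ᴬ_ : DecidableEquality A) (f : ℕ → A) (f-injective : ∀ {a b} → f a ≡ f b → a ≡ b) where

  injective-≤-length : ∀ r xs → (∀ {k} → k < r → f k ∈ xs) → r ≤ length xs
  injective-≤-length zero    xs _    = z≤n
  injective-≤-length (suc r) xs f∈xs =
    ≤-trans (s≤s (injective-≤-length r (filter ≢fr? xs) f∈rest)) (filter-notAll ≢fr? xs fr∈xs)
    where
    ≢fr? : ∀ x → Dec (x ≢ f r)
    ≢fr? x = ¬? (x ≟ᴬ f r)
    f∈rest : ∀ {k} → k < r → f k ∈ filter ≢fr? xs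
    f∈rest k<r = ∈-filter⁺ ≢fr? (f∈xs (m<n⇒m<1+n k<r)) (λ eq → <-irrefl (f-injective eq) k<r)
    fr∈xs : Any (λ x → ¬ (x ≢ f r)) xs
    fr∈xs = Any.map (λ eq ≢ → ≢ (sym eq)) (f∈xs ≤-refl)

length-filter-complement : ∀ {A : Set} {P : A → Set} (P? : ∀ x → Dec (P x)) xs →
                           length (filter P? xs) + length (filter (λ x → ¬? (P? x)) xs) ≡ length xs
length-filter-complement P? [] = refl
length-filter-complement P? (x ∷ xs) with P? x
... | yes _ = cong suc (length-filter-complement P? xs)
... | no _  = trans (+-suc _ _) (cong suc (length-filter-complement P? xs))

StrictMono : (ℕ → ℕ) → Set
StrictMono p = ∀ k → p k < p (suc k)

relabel : (ℕ → ℕ) → Edge → Edge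
relabel p (a , b) = (p a , p b)

Cross-sym : ∀ {e f} → Cross e f → Cross f e
Cross-sym (inj₁ c) = inj₂ c
Cross-sym (inj₂ c) = inj₁ c

Cross-irrefl : ∀ {e} → ¬ Cross e e
Cross-irrefl (inj₁ (a<a , _ , _)) = <-irrefl refl a<a
Cross-irrefl (inj₂ (a<a , _ , _)) = <-irrefl refl a<a

Cross⇒endpoint-between : ∀ {a b c d} → Cross (a , b) (c , d) → (a < c × c < b) ⊎ (a < d × d < b)
Cross⇒endpoint-between (inj₁ (a<c , c<b , _)) = inj₁ (a<c , c<b)
Cross⇒endpoint-between (inj₂ (_ , a<d , d<b)) = inj₂ (a<d , d<b)

Cross⇒endpoint-outside : ∀ {a b c d} → Cross (a , b) (c , d) → c < a ⊎ b < d
Cross⇒endpoint-outside (inj₁ (_ , _ , b<d)) = inj₂ b<d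
Cross⇒endpoint-outside (inj₂ (c<a , _ , _)) = inj₁ c<a

module _ {p : ℕ → ℕ} (p-mono : StrictMono p) where

  strictMono-< : ∀ {j k} → j < k → p j < p k
  strictMono-< {j} {suc k} (s≤s j≤k) with m≤n⇒m<n∨m≡n j≤k
  ... | inj₁ j<k  = <-trans (strictMono-< j<k) (p-mono k)
  ... | inj₂ refl = p-mono k

  strictMono-reflects-< : ∀ {j k} → p j < p k → j < k
  strictMono-reflects-< {j} {k} pj<pk with <-cmp j k
  ... | tri< j<k _ _ = j<k
  ... | tri≈ _ refl _ = ⊥-elim (<-irrefl refl pj<pk)
  ... | tri> _ _ k<j = ⊥-elim (<-asym pj<pk (strictMono-< k<j))

  strictMono-injective : ∀ {j k} → p j ≡ p k → j ≡ k
  strictMono-injective {j} {k} pj≡pk with <-cmp j k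
  ... | tri< j<k _ _ = ⊥-elim (<-irrefl pj≡pk (strictMono-< j<k))
  ... | tri≈ _ j≡k _ = j≡k
  ... | tri> _ _ k<j = ⊥-elim (<-irrefl (sym pj≡pk) (strictMono-< k<j))

  Cross-relabel⁺ : ∀ {e f} → Cross e f → Cross (relabel p e) (relabel p f)
  Cross-relabel⁺ (inj₁ (x , y , z)) = inj₁ (strictMono-< x , strictMono-< y , strictMono-< z)
  Cross-relabel⁺ (inj₂ (x , y , z)) = inj₂ (strictMono-< x , strictMono-< y , strictMono-< z)

  Cross-relabel⁻ : ∀ {e f} → Cross (relabel p e) (relabel p f) → Cross e f
  Cross-relabel⁻ (inj₁ (x , y , z)) = inj₁ (strictMono-reflects-< x , strictMono-reflects-< y , strictMono-reflects-< z)
  Cross-relabel⁻ (inj₂ (x , y , z)) = inj₂ (strictMono-reflects-< x , strictMono-reflects-< y , strictMono-reflects-< z)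

strictMono-∘ : ∀ {p q} → StrictMono p → StrictMono q → StrictMono (p ∘ q)
strictMono-∘ p-mono q-mono k = strictMono-< p-mono (q-mono k)

-- The ℕ-analogue of Fin's punchIn: skip v enumerates ℕ ∖ {v} in increasing order.
skip : ℕ → ℕ → ℕ
skip zero    k       = suc k
skip (suc v) zero    = zero
skip (suc v) (suc k) = suc (skip v k)

skip-view : ∀ v k → (k < v × skip v k ≡ k) ⊎ (v ≤ k × skip v k ≡ suc k)
skip-view zero    k       = inj₂ (z≤n , refl)
skip-view (suc v) zero    = inj₁ (s≤s z≤n , refl)
skip-view (suc v) (suc k) with skip-view v k
... | inj₁ (k<v , eq) = inj₁ (s≤s k<v , cong suc eq)
... | inj₂ (v≤k , eq) = inj₂ (s≤s v≤k , cong suc eq)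

skip-strictMono : ∀ v → StrictMono (skip v)
skip-strictMono zero    k       = ≤-refl
skip-strictMono (suc v) zero    = s≤s z≤n
skip-strictMono (suc v) (suc k) = s≤s (skip-strictMono v k)

skip-≢ : ∀ v k → skip v k ≢ v
skip-≢ zero    k       ()
skip-≢ (suc v) zero    ()
skip-≢ (suc v) (suc k) eq = skip-≢ v k (suc-injective eq)

skip-surjective : ∀ v a → a ≢ v → ∃ λ a′ → skip v a′ ≡ a × ((a < v × a′ ≡ a) ⊎ (v < a × suc a′ ≡ a))
skip-surjective v a a≢v with <-cmp a v
... | tri≈ _ a≡v _ = ⊥-elim (a≢v a≡v)
... | tri< a<v _ _ with skip-view v a
...   | inj₁ (_ , eq)  = a , eq , inj₁ (a<v , refl)
...   | inj₂ (v≤a , _) = ⊥-elim (<-irrefl refl (<-≤-trans a<v v≤a))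
skip-surjective v (suc a) a≢v | tri> _ _ (s≤s v≤a) with skip-view v a
...   | inj₁ (a<v , _) = ⊥-elim (<-irrefl refl (<-≤-trans a<v v≤a))
...   | inj₂ (_ , eq)  = a , eq , inj₂ (s≤s v≤a , refl)

earIndexAfter : ∀ {P : Set} → ℕ → Dec P → Edge
earIndexAfter k (yes _) = (0 , k)
earIndexAfter k (no _)  = (k , suc (suc k))

earIndex : ℕ → ℕ → Edge
earIndex m zero    = (1 , m ∸ 1)
earIndex m (suc k) = earIndexAfter k (suc (suc k) ≟ m)

data EarIndexView (M : ℕ) : ℕ → Set where
  ear-first  : earIndex (suc M) 0 ≡ (1 , M) → EarIndexView M 0
  ear-last   : ∀ {k} → suc k ≡ M → earIndex (suc M) (suc k) ≡ (0 , k) → EarIndexView M (suc k)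
  ear-middle : ∀ {k} → suc k < M → earIndex (suc M) (suc k) ≡ (k , suc (suc k)) → EarIndexView M (suc k)

earIndex-view : ∀ M v → v < suc M → EarIndexView M v
earIndex-view M zero    _ = ear-first refl
earIndex-view M (suc k) (s≤s k<M) with suc (suc k) ≟ suc M in eq
... | yes k+2≡m = ear-last (suc-injective k+2≡m) (cong (earIndexAfter k) eq)
... | no k+2≢m  = ear-middle (≤∧≢⇒< k<M (k+2≢m ∘ cong suc)) (cong (earIndexAfter k) eq)

earIndex-isDiagonal : ∀ {M v} → 3 ≤ M → v < suc M → IsDiagonal (suc M) (earIndex (suc M) v)
earIndex-isDiagonal {M} {v} 3≤M v<m with earIndex-view M v v<m
... | ear-first eq rewrite eq = 3≤M , ≤-refl , λ { (() , _) }
... | ear-last {k} refl eq rewrite eq =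
  ≤-pred 3≤M , s≤s (n≤1+n k) , λ { (_ , k+1≡k+2) → <-irrefl (suc-injective k+1≡k+2) (n<1+n k) }
... | ear-middle {k} k+1<M eq rewrite eq =
  ≤-reflexive (+-comm k 2) , s≤s k+1<M ,
  λ { (refl , 3≡M) → <-irrefl refl (≤-trans 3≤M (≤-reflexive (suc-injective (sym 3≡M)))) }

skip-isDiagonal : ∀ {M v j k} → IsDiagonal M (j , k) → IsDiagonal (suc M) (skip v j , skip v k)
skip-isDiagonal {M} {v} {j} {k} (j+2≤k , k<M , ¬side) = gap , bound , notSide
  where
  gap : skip v j + 2 ≤ skip v k
  gap with skip-view v j | skip-view v k
  ... | inj₁ (_ , e₁)   | inj₁ (_ , e₂) rewrite e₁ | e₂ = j+2≤k
  ... | inj₁ (_ , e₁)   | inj₂ (_ , e₂) rewrite e₁ | e₂ = ≤-trans j+2≤k (n≤1+n k)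
  ... | inj₂ (v≤j , _)  | inj₁ (k<v , _) =
    ⊥-elim (<-irrefl refl (<-≤-trans k<v (≤-trans v≤j (≤-trans (m≤m+n j 2) j+2≤k))))
  ... | inj₂ (_ , e₁)   | inj₂ (_ , e₂) rewrite e₁ | e₂ = s≤s j+2≤k
  bound : skip v k < suc M
  bound with skip-view v k
  ... | inj₁ (_ , e) rewrite e = m<n⇒m<1+n k<M
  ... | inj₂ (_ , e) rewrite e = s≤s k<M
  notSide : ¬ (skip v j ≡ 0 × suc (skip v k) ≡ suc M)
  notSide (j′≡0 , k′+1≡m) with skip-view v j | skip-view v k
  ... | inj₂ (_ , e₁) | _ with () ← trans (sym e₁) j′≡0
  ... | inj₁ (_ , e₁) | inj₁ (_ , e₂) = <-irrefl (trans (sym e₂) (suc-injective k′+1≡m)) k<M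
  ... | inj₁ (_ , e₁) | inj₂ (_ , e₂) = ¬side (trans (sym e₁) j′≡0 , trans (sym e₂) (suc-injective k′+1≡m))

earIndex-noCross : ∀ {M v s t} → v < suc M → s ≢ v → t ≢ v → t < suc M → ¬ Cross (earIndex (suc M) v) (s , t)
earIndex-noCross {M} {v} {s} {t} v<m s≢v t≢v t<m cr with earIndex-view M v v<m
... | ear-first eq rewrite eq with Cross⇒endpoint-outside cr
...   | inj₁ s<1 = s≢v (n<1⇒n≡0 s<1)
...   | inj₂ M<t = <-irrefl refl (<-≤-trans M<t (≤-pred t<m))
earIndex-noCross {M} {v} {s} {t} v<m s≢v t≢v t<m cr | ear-last refl eq rewrite eq with Cross⇒endpoint-outside cr
...   | inj₂ k<t = t≢v (≤-antisym (≤-pred t<m) k<t)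
earIndex-noCross {M} {v} {s} {t} v<m s≢v t≢v t<m cr | ear-middle _ eq rewrite eq with Cross⇒endpoint-between cr
...   | inj₁ (k<s , s<k+2) = s≢v (≤-antisym (≤-pred s<k+2) k<s)
...   | inj₂ (k<t , t<k+2) = t≢v (≤-antisym (≤-pred t<k+2) k<t)

Cross-earIndex-source : ∀ {M v b} → v < suc M → IsDiagonal (suc M) (v , b) → Cross (v , b) (earIndex (suc M) v)
Cross-earIndex-source {M} {v} {b} v<m (v+2≤b , b<m , ¬side) with earIndex-view M v v<m
... | ear-first eq rewrite eq = inj₁ (s≤s z≤n , v+2≤b , ≤∧≢⇒< (≤-pred b<m) (λ b≡M → ¬side (refl , cong suc b≡M)))
... | ear-last {k} refl eq rewrite eq =
  ⊥-elim (<-irrefl refl (<-≤-trans (m<m+n (suc k) (s≤s z≤n)) (≤-trans v+2≤b (≤-pred b<m))))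
... | ear-middle {k} _ eq rewrite eq = inj₂ (n<1+n k , n<1+n (suc k) , subst (_≤ b) (+-comm (suc k) 2) v+2≤b)

Cross-earIndex-target : ∀ {M v a} → v < suc M → IsDiagonal (suc M) (a , v) → Cross (a , v) (earIndex (suc M) v)
Cross-earIndex-target {M} {v} {a} v<m (a+2≤v , v<m′ , ¬side) with earIndex-view M v v<m
... | ear-first eq with () ← ≤-trans (m≤n+m 2 a) a+2≤v
... | ear-last {k} refl eq rewrite eq =
  inj₂ (n≢0⇒n>0 (λ a≡0 → ¬side (a≡0 , refl)) , ≤-pred (subst (_≤ suc k) (+-comm a 2) a+2≤v) , n<1+n k)
... | ear-middle {k} _ eq rewrite eq = inj₁ (≤-pred (subst (_≤ suc k) (+-comm a 2) a+2≤v) , n<1+n k , n<1+n (suc k))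

unskip-isDiagonal : ∀ {M v a b} → v < suc M → IsDiagonal (suc M) (a , b) → a ≢ v → b ≢ v →
                    (a , b) ≢ earIndex (suc M) v →
                    ∃ λ a′ → ∃ λ b′ → skip v a′ ≡ a × skip v b′ ≡ b × IsDiagonal M (a′ , b′)
unskip-isDiagonal {M} {v} {a} {b} v<m (a+2≤b , b<m , ¬side) a≢v b≢v ≢ear
  with skip-surjective v a a≢v | skip-surjective v b b≢v
... | _ , ea , inj₁ (a<v , refl) | _ , eb , inj₁ (b<v , refl) =
  a , b , ea , eb , a+2≤b , <-≤-trans b<v (≤-pred v<m) , ¬side′
  where
  ¬side′ : ¬ (a ≡ 0 × suc b ≡ M)
  ¬side′ (refl , b+1≡M) with earIndex-view M v v<m
  ... | ear-first _ = <-irrefl refl a<v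
  ... | ear-last refl eq = ≢ear (trans (cong (0 ,_) (suc-injective b+1≡M)) (sym eq))
  ... | ear-middle k+1<M _ = <-irrefl refl (<-≤-trans k+1<M (≤-trans (≤-reflexive (sym b+1≡M)) b<v))
... | _ , ea , inj₁ (a<v , refl) | b′ , eb , inj₂ (v<b , refl) =
  a , b′ , ea , eb , gap , ≤-pred b<m , λ (a≡0 , b′+1≡M) → ¬side (a≡0 , cong suc b′+1≡M)
  where
  gap : a + 2 ≤ b′
  gap with m≤n⇒m<n∨m≡n a+2≤b
  ... | inj₁ a+2<b = ≤-pred a+2<b
  ... | inj₂ a+2≡b with earIndex-view M v v<m
  ...   | ear-first _ = ⊥-elim (<-irrefl refl (<-≤-trans a<v z≤n))
  ...   | ear-last refl _ = ⊥-elim (<-irrefl refl (<-≤-trans b<m v<b))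
  ...   | ear-middle {k} _ eq = ⊥-elim (≢ear (trans (cong₂ _,_ a≡k b≡k+2) (sym eq)))
    where
    a≡k : a ≡ k
    a≡k = ≤-antisym (≤-pred a<v) (≤-pred (≤-pred (≤-trans v<b (≤-reflexive (trans (sym a+2≡b) (+-comm a 2))))))
    b≡k+2 : suc b′ ≡ suc (suc k)
    b≡k+2 = trans (sym a+2≡b) (trans (+-comm a 2) (cong (suc ∘ suc) a≡k))
... | a′ , _ , inj₂ (v<a , refl) | _ , _ , inj₁ (b<v , refl) =
  ⊥-elim (<-irrefl refl (<-trans v<a (<-trans (≤-trans (m<m+n (suc a′) (s≤s z≤n)) a+2≤b) b<v)))
... | a′ , ea , inj₂ (v<a , refl) | b′ , eb , inj₂ (v<b , refl) =
  a′ , b′ , ea , eb , ≤-pred a+2≤b , ≤-pred b<m , ¬side′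
  where
  ¬side′ : ¬ (a′ ≡ 0 × suc b′ ≡ M)
  ¬side′ (refl , refl) with earIndex-view M v v<m
  ... | ear-first eq = ≢ear (sym eq)
  ... | ear-last _ _ = <-irrefl refl (<-≤-trans (s≤s z≤n) (≤-pred v<a))
  ... | ear-middle _ _ = <-irrefl refl (<-≤-trans (s≤s z≤n) (≤-pred v<a))

-- Triangulations of the convex polygon whose vertices, in order, carry the labels p 0 < p 1 < … < p (m-1).
record PolyDiagonal (p : ℕ → ℕ) (m : ℕ) (e : Edge) : Set where
  constructor polyDiagonal
  field
    indices    : Edge
    isDiagonal : IsDiagonal m indices
    labelled   : e ≡ relabel p indices

record PolyTriangulation (p : ℕ → ℕ) (m : ℕ) (T : List Edge) : Set where
  field
    diagonals   : ∀ {e} → e ∈ T → PolyDiagonal p m e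
    nonCrossing : ∀ {e f} → e ∈ T → f ∈ T → ¬ Cross e f
    maximal     : ∀ d → PolyDiagonal p m d → d ∉ T → ∃ λ f → f ∈ T × Cross d f

polyEar : (ℕ → ℕ) → ℕ → ℕ → Edge
polyEar p m v = relabel p (earIndex m v)

extendByEar : ∀ {p} → StrictMono p → ∀ {M v T} → 3 ≤ M → v < suc M →
              PolyTriangulation (p ∘ skip v) M T → PolyTriangulation p (suc M) (polyEar p (suc M) v ∷ T)
extendByEar {p} p-mono {M} {v} {T} 3≤M v<m tri = record
  { diagonals = diagonals ; nonCrossing = nonCrossing ; maximal = maximal }
  where
  open PolyTriangulation tri renaming (diagonals to diagonalsᵀ; nonCrossing to nonCrossingᵀ; maximal to maximalᵀ)
  ear : Edge
  ear = polyEar p (suc M) v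

  diagonals : ∀ {e} → e ∈ ear ∷ T → PolyDiagonal p (suc M) e
  diagonals (here refl) = polyDiagonal _ (earIndex-isDiagonal 3≤M v<m) refl
  diagonals (there e∈T) with diagonalsᵀ e∈T
  ... | polyDiagonal (j , k) d eq = polyDiagonal (skip v j , skip v k) (skip-isDiagonal d) eq

  ear-noCross : ∀ {f} → f ∈ T → ¬ Cross ear f
  ear-noCross f∈T cr with diagonalsᵀ f∈T
  ... | polyDiagonal (j , k) d refl =
    earIndex-noCross v<m (skip-≢ v j) (skip-≢ v k) (proj₁ (proj₂ (skip-isDiagonal {v = v} d)))
                     (Cross-relabel⁻ p-mono cr)

  nonCrossing : ∀ {e f} → e ∈ ear ∷ T → f ∈ ear ∷ T → ¬ Cross e f
  nonCrossing (here refl) (here refl) = Cross-irrefl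
  nonCrossing (here refl) (there f∈T) = ear-noCross f∈T
  nonCrossing (there e∈T) (here refl) = ear-noCross e∈T ∘ Cross-sym
  nonCrossing (there e∈T) (there f∈T) = nonCrossingᵀ e∈T f∈T

  maximal : ∀ d → PolyDiagonal p (suc M) d → d ∉ ear ∷ T → ∃ λ f → f ∈ ear ∷ T × Cross d f
  maximal d (polyDiagonal (a , b) isDiag refl) d∉ with a ≟ v | b ≟ v
  ... | yes refl | _ = ear , here refl , Cross-relabel⁺ p-mono (Cross-earIndex-source v<m isDiag)
  ... | no _ | yes refl = ear , here refl , Cross-relabel⁺ p-mono (Cross-earIndex-target v<m isDiag)
  ... | no a≢v | no b≢v
    with unskip-isDiagonal v<m isDiag a≢v b≢v (λ eq → d∉ (here (cong (relabel p) eq)))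
  ... | a′ , b′ , refl , refl , isDiag′ with maximalᵀ d (polyDiagonal (a′ , b′) isDiag′ refl) (d∉ ∘ there)
  ... | f , f∈T , cr = f , there f∈T , cr

Incident : Edge → ℕ → Set
Incident e a = proj₁ e ≡ a ⊎ proj₂ e ≡ a

incident? : ∀ e a → Dec (Incident e a)
incident? e a = (proj₁ e ≟ a) ⊎-dec (proj₂ e ≟ a)

polyDiagonal-skip-¬Incident : ∀ {p} → StrictMono p → ∀ {v M e} → PolyDiagonal (p ∘ skip v) M e → ¬ Incident e (p v)
polyDiagonal-skip-¬Incident p-mono {v} (polyDiagonal (j , k) _ refl) (inj₁ eq) = skip-≢ v j (strictMono-injective p-mono eq)
polyDiagonal-skip-¬Incident p-mono {v} (polyDiagonal (j , k) _ refl) (inj₂ eq) = skip-≢ v k (strictMono-injective p-mono eq)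

Avoids : List Edge → List Edge → Set
Avoids T S = ∀ {e} → e ∈ T → e ∉ S

AvoidingTriangulation : (ℕ → ℕ) → ℕ → List Edge → Set
AvoidingTriangulation p m S = ∃ λ T → PolyTriangulation p m T × Avoids T S

triangle-noDiagonal : ∀ {e} → ¬ IsDiagonal 3 e
triangle-noDiagonal {zero , k}  (2≤k , k<3 , ¬side) = ¬side (refl , cong suc (≤-antisym (≤-pred k<3) 2≤k))
triangle-noDiagonal {suc j , k} (j+3≤k , k<3 , _) =
  <-irrefl refl (≤-trans (m≤n+m 3 j) (≤-trans (≤-reflexive (+-suc j 2)) (≤-trans j+3≤k (≤-pred k<3))))

triangle-triangulation : ∀ {p} → PolyTriangulation p 3 []
triangle-triangulation = record
  { diagonals = λ () ; nonCrossing = λ () ; maximal = λ { _ (polyDiagonal _ d _) _ → ⊥-elim (triangle-noDiagonal d) } }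

middleEar : (ℕ → ℕ) → ℕ → Edge
middleEar p k = (p k , p (suc (suc k)))

middleEar-injective : ∀ {p} → StrictMono p → ∀ {j k} → middleEar p j ≡ middleEar p k → j ≡ k
middleEar-injective p-mono eq = strictMono-injective p-mono (cong proj₁ eq)

polyEar-middle : ∀ {p M k} → suc (suc k) < suc M → polyEar p (suc M) (suc k) ≡ middleEar p k
polyEar-middle {p} {M} {k} k+2<m with earIndex-view M (suc k) (<-trans (n<1+n _) k+2<m)
... | ear-last refl _ = ⊥-elim (<-irrefl refl (≤-pred k+2<m))
... | ear-middle _ eq = cong (relabel p) eq

-- The middle vertices of a polygon with 2 + r vertices are p 1, …, p r.
TouchesMiddle : (ℕ → ℕ) → ℕ → Edge → Set
TouchesMiddle p r e = ∃ λ k → k < r × Incident e (p (suc k))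

touchesMiddle? : ∀ p r e → Dec (TouchesMiddle p r e)
touchesMiddle? p r e = anyUpTo? (λ k → incident? e (p (suc k))) r

polyDiagonal-touchesMiddle : ∀ {p r e} → PolyDiagonal p (suc (suc r)) e → TouchesMiddle p r e
polyDiagonal-touchesMiddle (polyDiagonal (suc j , k) (j+3≤k , k<m , _) refl) =
  j , <-≤-trans (m<m+n j (s≤s z≤n)) (≤-pred (≤-trans j+3≤k (≤-pred k<m))) , inj₁ refl
polyDiagonal-touchesMiddle (polyDiagonal (zero , suc k) (_ , k+1<m , ¬side) refl) =
  k , ≤∧≢⇒< (≤-pred (≤-pred k+1<m)) (λ k≡r → ¬side (refl , cong (suc ∘ suc) k≡r)) , inj₂ refl

module CutEar {p : ℕ → ℕ} (p-mono : StrictMono p) {r : ℕ} (2≤r : 2 ≤ r)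
              (induction : ∀ {q} → StrictMono q → ∀ S → length S + 3 ≤ suc r → AvoidingTriangulation q (suc r) S)
              (S : List Edge) (|S|+3≤m : length S + 3 ≤ suc (suc r)) where

  m : ℕ
  m = suc (suc r)

  S₁ : List Edge
  S₁ = filter (touchesMiddle? p r) S

  |S₁|+3≤m : length S₁ + 3 ≤ m
  |S₁|+3≤m = ≤-trans (+-monoˡ-≤ 3 (length-filter (touchesMiddle? p r) S)) |S|+3≤m

  avoidsS₁⇒avoidsS : ∀ {T} → PolyTriangulation p m T → Avoids T S₁ → Avoids T S
  avoidsS₁⇒avoidsS tri avoids e∈T e∈S =
    avoids e∈T (∈-filter⁺ (touchesMiddle? p r) e∈S (polyDiagonal-touchesMiddle (PolyTriangulation.diagonals tri e∈T)))

  Touches : ℕ → Set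
  Touches k = Any (λ e → Incident e (p (suc k))) S₁

  -- p (suc k) can be cut off: its ear-cover is not in S₁, and the edges of S₁ not meeting it still
  -- number at most (m - 1) - 3.
  Cuttable : ℕ → Set
  Cuttable k = middleEar p k ∉ S₁ × (length S₁ + 3 < m ⊎ Touches k)

  cuttable? : ∀ k → Dec (Cuttable k)
  cuttable? k = ¬? (middleEar p k ∈? S₁) ×-dec ((length S₁ + 3 <? m) ⊎-dec any? (λ e → incident? e (p (suc k))) S₁)

  cut : ∀ {k} → k < r → Cuttable k → AvoidingTriangulation p m S
  cut {k} k<r (ear∉S₁ , shrinks) with induction (strictMono-∘ p-mono (skip-strictMono (suc k))) S₂ |S₂|+3≤m-1
    where
    ¬incident? : ∀ e → Dec (¬ Incident e (p (suc k)))
    ¬incident? e = ¬? (incident? e (p (suc k)))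
    S₂ : List Edge
    S₂ = filter ¬incident? S₁
    |S₂|<|S₁| : Touches k → length S₂ < length S₁
    |S₂|<|S₁| touches = filter-notAll ¬incident? S₁ (Any.map (λ i ¬i → ¬i i) touches)
    |S₂|+3≤m-1 : length S₂ + 3 ≤ suc r
    |S₂|+3≤m-1 = [ (λ short → ≤-trans (+-monoˡ-≤ 3 (length-filter ¬incident? S₁)) (≤-pred short))
                 , (λ touches → ≤-pred (<-≤-trans (+-monoˡ-< 3 (|S₂|<|S₁| touches)) |S₁|+3≤m))
                 ]′ shrinks
  ... | T , tri , avoids = _ , tri′ , avoidsS₁⇒avoidsS tri′ avoids′
    where
    tri′ : PolyTriangulation p m (polyEar p m (suc k) ∷ T)
    tri′ = extendByEar p-mono (s≤s 2≤r) (s≤s (<-trans k<r (n<1+n r))) tri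
    avoids′ : Avoids (polyEar p m (suc k) ∷ T) S₁
    avoids′ (here refl) = subst (_∉ S₁) (sym (polyEar-middle {p} (s≤s (s≤s k<r)))) ear∉S₁
    avoids′ (there e∈T) e∈S₁ = avoids e∈T
      (∈-filter⁺ _ e∈S₁ (polyDiagonal-skip-¬Incident p-mono (PolyTriangulation.diagonals tri e∈T)))

  notAllMiddleEars : ¬ (∀ {k} → k < r → middleEar p k ∈ S₁)
  notAllMiddleEars all∈ = <-irrefl refl (≤-trans (+-monoʳ-≤ 3 r≤|S₁|) (≤-trans (≤-reflexive (+-comm 3 _)) |S₁|+3≤m))
    where
    r≤|S₁| : r ≤ length S₁
    r≤|S₁| = injective-≤-length (≡-dec _≟_ _≟_) (middleEar p) (middleEar-injective p-mono) r S₁ all∈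

  module NoCuttable (none : ¬ (∃ λ k → k < r × Cuttable k)) where

    middleEar∈S₁ : ∀ {k} → k < r → (length S₁ + 3 < m ⊎ Touches k) → middleEar p k ∈ S₁
    middleEar∈S₁ {k} k<r shrinks with middleEar p k ∈? S₁
    ... | yes ear∈ = ear∈
    ... | no ear∉  = ⊥-elim (none (k , k<r , ear∉ , shrinks))

    element : ∀ (xs : List Edge) → ¬ (length xs + 3 < m) → ∃ (_∈ xs)
    element []      ¬short = ⊥-elim (¬short (s≤s (s≤s 2≤r)))
    element (x ∷ _) _      = x , here refl

    -- Without room to spare, the ear at a touched middle vertex lies in S₁ and touches both neighbours.
    allTouched : ¬ (length S₁ + 3 < m) → ∀ {k} → k < r → Touches k
    allTouched ¬short with (e , e∈S₁) ← element S₁ ¬short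
      with (_ , k₀ , k₀<r , incident) ← ∈-filter⁻ (touchesMiddle? p r) {xs = S} e∈S₁
      = neighbourClosed-all touch⁺ touch⁻ k₀<r (lose e∈S₁ incident)
      where
      touch⁺ : ∀ {k} → suc k < r → Touches k → Touches (suc k)
      touch⁺ k+1<r t = lose (middleEar∈S₁ (<-trans (n<1+n _) k+1<r) (inj₂ t)) (inj₂ refl)
      touch⁻ : ∀ {k} → suc k < r → Touches (suc k) → Touches k
      touch⁻ k+1<r t = lose (middleEar∈S₁ k+1<r (inj₂ t)) (inj₁ refl)

    contradiction : ⊥
    contradiction with length S₁ + 3 <? m
    ... | yes short = notAllMiddleEars (λ k<r → middleEar∈S₁ k<r (inj₁ short))
    ... | no ¬short = notAllMiddleEars (λ k<r → middleEar∈S₁ k<r (inj₂ (allTouched ¬short k<r)))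

  cuttableVertex : ∃ λ k → k < r × Cuttable k
  cuttableVertex with anyUpTo? cuttable? r
  ... | yes found = found
  ... | no none   = ⊥-elim (NoCuttable.contradiction none)

  cutEar : AvoidingTriangulation p m S
  cutEar = let k , k<r , cuttable = cuttableVertex in cut k<r cuttable

avoidingTriangulation : ∀ m {p} → StrictMono p → 3 ≤ m → ∀ S → length S + 3 ≤ m → AvoidingTriangulation p m S
avoidingTriangulation 1 _ (s≤s ()) _ _
avoidingTriangulation 2 _ (s≤s (s≤s ())) _ _
avoidingTriangulation 3 _ _ _ _ = [] , triangle-triangulation , λ ()
avoidingTriangulation (suc (suc (suc (suc r)))) p-mono _ S |S|+3≤m =
  CutEar.cutEar p-mono (s≤s (s≤s z≤n))
                (λ q-mono → avoidingTriangulation (suc (suc (suc r))) q-mono (s≤s (s≤s (s≤s z≤n))))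
                S |S|+3≤m

polyTriangulation-isTriangulation : ∀ {m T} → PolyTriangulation id m T → IsTriangulation m T
polyTriangulation-isTriangulation tri = record
  { diagonals   = λ e∈T → isDiagonal (diagonals e∈T)
  ; nonCrossing = nonCrossing
  ; maximal     = λ d isDiag → maximal d (polyDiagonal d isDiag refl) }
  where
  open PolyTriangulation tri
  isDiagonal : ∀ {m e} → PolyDiagonal id m e → IsDiagonal m e
  isDiagonal (polyDiagonal _ d refl) = d

edge-≤ : ∀ {a b} → a ≤ b → edge a b ≡ (a , b)
edge-≤ {a} {b} a≤b with a ≤ᵇ b | ≤⇒≤ᵇ a≤b
... | true | _ = refl

edge-> : ∀ {a b} → b < a → edge a b ≡ (b , a)
edge-> {a} {b} b<a with a ≤ᵇ b | ≤ᵇ⇒≤ a b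
... | true  | a≤b = ⊥-elim (<⇒≱ b<a (a≤b tt))
... | false | _   = refl

earIndex-earCover : ∀ {M i} → 3 ≤ M → i < suc M → earIndex (suc M) i ≡ earCover (suc M) i
earIndex-earCover {M} {i} 3≤M i<m with earIndex-view M i i<m
... | ear-first eq = begin
  earIndex (suc M) 0                  ≡⟨ eq ⟩
  (1 , M)                             ≡⟨ edge-> 1<M ⟨
  edge M 1                            ≡⟨ cong₂ edge (m<n⇒m%n≡m (n<1+n M)) (m<n⇒m%n≡m (m<n⇒m<1+n 1<M)) ⟨
  earCover (suc M) 0                  ∎
  where
  open ≡-Reasoning
  1<M : 1 < M
  1<M = <-≤-trans (s≤s (s≤s z≤n)) 3≤M
... | ear-last {k} refl eq = begin
  earIndex (suc (suc k)) (suc k)      ≡⟨ eq ⟩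
  (0 , k)                             ≡⟨ edge-> (<-≤-trans (s≤s z≤n) (≤-pred 3≤M)) ⟨
  edge k 0                            ≡⟨ cong₂ edge (trans ([m+n]%n≡m%n k (suc (suc k))) (m<n⇒m%n≡m (<-trans (n<1+n k) (n<1+n (suc k)))))
                                                    (n%n≡0 (suc (suc k))) ⟨
  earCover (suc (suc k)) (suc k)      ∎
  where open ≡-Reasoning
... | ear-middle {k} k+1<M eq = begin
  earIndex (suc M) (suc k)            ≡⟨ eq ⟩
  (k , suc (suc k))                   ≡⟨ edge-≤ (≤-trans (n≤1+n k) (n≤1+n (suc k))) ⟨
  edge k (suc (suc k))                ≡⟨ cong₂ edge (trans ([m+n]%n≡m%n k (suc M)) (m<n⇒m%n≡m (<-trans (n<1+n k) (<-trans k+1<M (n<1+n M)))))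
                                                    (m<n⇒m%n≡m (s≤s k+1<M)) ⟨
  earCover (suc M) (suc k)            ∎
  where open ≡-Reasoning

offStar : ℕ → List Edge → List Edge
offStar i B = filter (λ e → ¬? (incident? e i)) B

-- Cutting off the ear at i, a triangulation of the remaining polygon that misses offStar i B misses B.
earCover∉blocker⇒offStar-large : ∀ {M B i} → i < suc M → IsBlocker (suc M) B → earCover (suc M) i ∉ B →
                                 ¬ (length (offStar i B) + 3 ≤ M)
earCover∉blocker⇒offStar-large {M} {B} {i} i<m blocker ear∉B small =
  missesB (avoidingTriangulation M (skip-strictMono i) 3≤M (offStar i B) small)
  where
  3≤M : 3 ≤ M
  3≤M = ≤-trans (m≤n+m 3 _) small
  missesB : AvoidingTriangulation (skip i) M (offStar i B) → ⊥
  missesB (T , tri , avoids) with blocker _ (polyTriangulation-isTriangulation (extendByEar n<1+n 3≤M i<m tri))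
  ... | _ , e∈B , here refl  = ear∉B (subst (_∈ B) (earIndex-earCover 3≤M i<m) e∈B)
  ... | _ , e∈B , there e∈T =
    avoids e∈T (∈-filter⁺ _ e∈B (polyDiagonal-skip-¬Incident n<1+n (PolyTriangulation.diagonals tri e∈T)))

mainTheorem11 : ∀ (n : ℕ) (B : List Edge) → 3 ≤ n → IsNKBlocker n (n ∸ 1) B
                  → ∀ (i : ℕ) → i < n → earCover n i ∉ B → deg B i ≤ 2
mainTheorem11 zero    _ () _ _ _ _
mainTheorem11 (suc M) B _ nkBlocker i i<n ear∉B with deg B i ≤? 2
... | yes deg≤2 = deg≤2
... | no  deg≰2 = ⊥-elim (earCover∉blocker⇒offStar-large i<n blocker ear∉B offStar-small)
  where
  open IsNKBlocker nkBlocker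
  deg+offStar : deg B i + length (offStar i B) ≡ M
  deg+offStar = trans (length-filter-complement (λ e → incident? e i) B) size
  offStar-small : length (offStar i B) + 3 ≤ M
  offStar-small = begin
    length (offStar i B) + 3       ≡⟨ +-comm _ 3 ⟩
    3 + length (offStar i B)       ≤⟨ +-monoˡ-≤ _ (≰⇒> deg≰2) ⟩
    deg B i + length (offStar i B) ≡⟨ deg+offStar ⟩
    M                              ∎
    where open ≤-Reasoning
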